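{- Let $H$ be a digraph with vertex set $V(H)=\{1,\dots,n\}$ (loops allowed, no multiple arcs). Let $T$ be an $n$-partitioned graph and suppose that $T\cong T_1\circ_H T_2\circ_H\cdots\circ_H T_k$ and $T\cong R_1\circ_H R_2\circ_H\cdots\circ_H R_l$, where $k,l\ge 1$ and all $T_i$ and $R_j$ are $H$-prime $n$-partitioned graphs. Then $k=l$, and the sequence $(R_1,\dots,R_k)$ can be obtained, up to isomorphism of the individual factors, from the sequence $(T_1,\dots,T_k)$ by finitely many interchanges of two consecutive factors $P,Q$ satisfying $P\circ_H Q\cong Q\circ_H P$. (That is, the $H$-decomposition of every $n$-partitioned graph is unique up to permutation of standing-together commuting factors.)
   Context: All graphs are finite, simple and undirected; digraphs may have loops but no multiple arcs. An $n$-partitioned graph is a tuple $T=(G,A_1,\dots,A_n)$ where $G$ is a graph and $(A_1,\dots,A_n)$ is a partition of $V(G)$ into pairwise disjoint sets, some of which may be empty. Two $n$-partitioned graphs $(G,A_1,\dots,A_n)$ and $(F,B_1,\dots,B_n)$ are isomorphic if there is a graph isomorphism $f:G\to F$ with $f(A_i)=B_i$ for all $i$; $n$-partitioned graphs are considered up to this isomorphism. For a digraph $H$ on $\{1,\dots,n\}$, the $H$-product of $(G,A_1,\dots,A_n)$ and $(F,B_1,\dots,B_n)$ (with $V(G)\cap V(F)=\emptyset$) is $(R,A_1\cup B_1,\dots,A_n\cup B_n)$, where $V(R)=V(G)\cup V(F)$ and $E(R)=E(G)\cup E(F)\cup\{xy: x\in A_i,\ y\in B_j,\ (i,j)\in A(H)\}$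 (here $(i,i)$ may be a loop of $H$). This operation is associative. An $n$-partitioned graph $T$ is $H$-decomposable if $T\cong T_1\circ_H T_2$ for $n$-partitioned graphs $T_1,T_2$ with nonempty vertex sets, and $H$-prime otherwise. -}

module Defs where

open import Data.Nat using (ℕ; _+_; _≤_)
open import Data.Bool using (Bool; true; false)
open import Data.Fin using (Fin; splitAt)
open import Data.Sum using (_⊎_; inj₁; inj₂)
open import Data.Product using (Σ; ∃; _×_; _,_)
open import Data.List using (List; []; _∷_; _++_; length)
open import Data.List.Relation.Binary.Pointwise using (Pointwise)
open import Relation.Binary.Construct.Closure.ReflexiveTransitive using (Star)
open import Relation.Binary.PropositionalEquality using (_≡_; refl)
open import Relation.Nullary using (¬_)
open import Function.Bundles using (_↔_; Inverse)

Digraph : ℕ → Set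
Digraph n = Fin n → Fin n → Bool

-- The classes A_i = part⁻¹(i) are pairwise disjoint, cover V(G), may be empty.
record PGraph (n : ℕ) : Set where
  field
    size   : ℕ
    adj    : Fin size → Fin size → Bool
    sym    : ∀ x y → adj x y ≡ adj y x
    irrefl : ∀ x → adj x x ≡ false
    part   : Fin size → Fin n
open PGraph public

record _≅_ {n : ℕ} (G F : PGraph n) : Set where
  field
    bij      : Fin (size G) ↔ Fin (size F)
    adj-pres : ∀ x y → adj F (Inverse.to bij x) (Inverse.to bij y) ≡ adj G x y
    part-pres : ∀ x → part F (Inverse.to bij x) ≡ part G x
infix 4 _≅_

module ProdDef {n : ℕ} (H : Digraph n) (G F : PGraph n) where
  V = Fin (size G) ⊎ Fin (size F)

  adj⊎ : V → V → Bool
  adj⊎ (inj₁ x) (inj₁ y) = adj G x y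
  adj⊎ (inj₂ x) (inj₂ y) = adj F x y
  adj⊎ (inj₁ x) (inj₂ y) = H (part G x) (part F y)
  adj⊎ (inj₂ y) (inj₁ x) = H (part G x) (part F y)

  sym⊎ : ∀ u v → adj⊎ u v ≡ adj⊎ v u
  sym⊎ (inj₁ x) (inj₁ y) = sym G x y
  sym⊎ (inj₂ x) (inj₂ y) = sym F x y
  sym⊎ (inj₁ x) (inj₂ y) = refl
  sym⊎ (inj₂ y) (inj₁ x) = refl

  irr⊎ : ∀ u → adj⊎ u u ≡ false
  irr⊎ (inj₁ x) = irrefl G x
  irr⊎ (inj₂ x) = irrefl F x

  part⊎ : V → Fin n
  part⊎ (inj₁ x) = part G x
  part⊎ (inj₂ x) = part F x

  prod : PGraph n
  prod = record
    { size   = size G + size F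
    ; adj    = λ x y → adj⊎ (splitAt (size G) x) (splitAt (size G) y)
    ; sym    = λ x y → sym⊎ (splitAt (size G) x) (splitAt (size G) y)
    ; irrefl = λ x → irr⊎ (splitAt (size G) x)
    ; part   = λ x → part⊎ (splitAt (size G) x)
    }

_∘[_]_ : ∀ {n} → PGraph n → Digraph n → PGraph n → PGraph n
G ∘[ H ] F = ProdDef.prod H G F
infixr 6 _∘[_]_

Nonempty : ∀ {n} → PGraph n → Set
Nonempty G = 1 ≤ size G

HDecomposable : ∀ {n} → Digraph n → PGraph n → Set
HDecomposable H T =
  Σ (PGraph _) λ T₁ → Σ (PGraph _) λ T₂ →
    Nonempty T₁ × Nonempty T₂ × (T ≅ T₁ ∘[ H ] T₂)

HPrime : ∀ {n} → Digraph n → PGraph n → Set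
HPrime H T = ¬ HDecomposable H T

-- Product of a nonempty sequence T₁ ∘ T₂ ∘ ⋯ ∘ Tₖ (bracketed to the right;
-- the operation is associative), given as head and tail.
prodSeq : ∀ {n} → Digraph n → PGraph n → List (PGraph n) → PGraph n
prodSeq H T []       = T
prodSeq H T (S ∷ Ss) = T ∘[ H ] prodSeq H S Ss

data SwapStep {n : ℕ} (H : Digraph n) : List (PGraph n) → List (PGraph n) → Set where
  swap : ∀ xs P Q ys → (P ∘[ H ] Q) ≅ (Q ∘[ H ] P) →
         SwapStep H (xs ++ P ∷ Q ∷ ys) (xs ++ Q ∷ P ∷ ys)

Swaps : ∀ {n} → Digraph n → List (PGraph n) → List (PGraph n) → Set
Swaps H = Star (SwapStep H)

-- The argument works with "structures": n-partitioned graphs whose vertex set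
-- is an arbitrary type, so that products are disjoint sums and factors can be
-- cut out as subtypes.  The heart of it is the refinement lemma: if
-- P ⊗ A ≃ X ⊗ Y, colouring every vertex of P ⊗ A by the side of X ⊗ Y it is
-- sent to splits P = P₁ ⊗ P₂ and A = A₁ ⊗ A₂ with X ≃ P₁ ⊗ A₁, Y ≃ P₂ ⊗ A₂,
-- and the middle factors P₂, A₁ commute.  Finite subsets of Fin m are
-- enumerated, so the pieces are again n-partitioned graphs.
--
-- From the refinement lemma, a nonempty prime factor P of a product of primes
-- T₁ ⊗ ⋯ ⊗ Tₖ either equals T₁ (if P₁ is nonempty), or commutes with T₁ and is
-- a factor of T₂ ⊗ ⋯ ⊗ Tₖ; by induction the list can be rearranged by commuting
-- swaps so that a copy of P comes first (the extraction lemma).  Peeling off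
-- the factors of the second factorisation one by one proves the theorem.
module Submission where

open import Defs
open import Data.Nat using (ℕ; zero; suc; s≤s; z≤n)
open import Data.Bool using (Bool; true; false)
open import Data.Bool.Properties using () renaming (_≟_ to _≟ᵇ_)
open import Data.Fin using (Fin; splitAt; join) renaming (zero to fzero; suc to fsuc)
open import Data.Fin.Properties using (splitAt-join; join-splitAt)
open import Data.Sum using (_⊎_; inj₁; inj₂)
open import Data.Product using (Σ; _×_; _,_; proj₁; proj₂)
open import Data.List using (List; []; _∷_; length)
open import Data.List.Properties using (length-++)
open import Data.List.Relation.Unary.All using (All; []; _∷_)
open import Data.List.Relation.Unary.All.Properties using (++⁺; ++⁻)
open import Data.List.Relation.Binary.Pointwise using (Pointwise; []; _∷_)
open import Data.Empty using (⊥-elim)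
open import Function using (_∘_)
open import Function.Bundles using (_↔_; Inverse; mk↔ₛ′)
open import Function.Properties.Inverse using (↔-trans)
open import Relation.Nullary using (¬_; yes; no)
open import Relation.Binary.Bundles using (Setoid)
import Relation.Binary.Reasoning.Setoid as SetoidReasoning
import Level
open import Relation.Binary.PropositionalEquality
  using (_≡_; refl; trans; cong; cong₂; subst; module ≡-Reasoning) renaming (sym to ≡-sym)
open import Relation.Binary.Construct.Closure.ReflexiveTransitive
  using (ε; _◅_; _◅◅_; fold; gmap)
open import Axiom.UniquenessOfIdentityProofs using (module Decidable⇒UIP)

-- Proofs of equalities between booleans are unique, so membership in a subset
-- cut out by a Boolean predicate carries no information.
bool-uip : {a b : Bool} (p q : a ≡ b) → p ≡ q
bool-uip = Decidable⇒UIP.≡-irrelevant _≟ᵇ_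

subset-≡ : {A : Set} {q : A → Bool} {b : Bool} {u v : Σ A (λ x → q x ≡ b)} →
           proj₁ u ≡ proj₁ v → u ≡ v
subset-≡ {u = x , e} {v = .x , e'} refl = cong (x ,_) (bool-uip e e')

Enumeration : Set → Set
Enumeration A = Σ ℕ λ k → Fin k ↔ A

Σ-Fin-suc : {m : ℕ} {P : Fin (suc m) → Set} →
            (P fzero ⊎ Σ (Fin m) (P ∘ fsuc)) ↔ Σ (Fin (suc m)) P
Σ-Fin-suc {m} {P} = mk↔ₛ′ to from to-from from-to
  where
  to : P fzero ⊎ Σ (Fin m) (P ∘ fsuc) → Σ (Fin (suc m)) P
  to (inj₁ p)       = fzero , p
  to (inj₂ (v , p)) = fsuc v , p
  from : Σ (Fin (suc m)) P → P fzero ⊎ Σ (Fin m) (P ∘ fsuc)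
  from (fzero , p)  = inj₁ p
  from (fsuc v , p) = inj₂ (v , p)
  to-from : ∀ y → to (from y) ≡ y
  to-from (fzero , p)  = refl
  to-from (fsuc v , p) = refl
  from-to : ∀ x → from (to x) ≡ x
  from-to (inj₁ p)       = refl
  from-to (inj₂ (v , p)) = refl

enum-point : {k : ℕ} {A B : Set} → A → (∀ (x y : A) → x ≡ y) →
             Fin k ↔ B → Fin (suc k) ↔ (A ⊎ B)
enum-point {k} {A} {B} a A-prop e = mk↔ₛ′ to from to-from from-to
  where
  open Inverse e renaming (to to toB; from to fromB)
  to : Fin (suc k) → A ⊎ B
  to fzero    = inj₁ a
  to (fsuc i) = inj₂ (toB i)
  from : A ⊎ B → Fin (suc k)
  from (inj₁ _) = fzero
  from (inj₂ y) = fsuc (fromB y)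
  to-from : ∀ y → to (from y) ≡ y
  to-from (inj₁ x) = cong inj₁ (A-prop a x)
  to-from (inj₂ y) = cong inj₂ (strictlyInverseˡ y)
  from-to : ∀ i → from (to i) ≡ i
  from-to fzero    = refl
  from-to (fsuc i) = cong fsuc (strictlyInverseʳ i)

enum-skip : {k : ℕ} {A B : Set} → ¬ A → Fin k ↔ B → Fin k ↔ (A ⊎ B)
enum-skip {k} {A} {B} ¬a e = mk↔ₛ′ (inj₂ ∘ toB) from to-from strictlyInverseʳ
  where
  open Inverse e renaming (to to toB; from to fromB)
  from : A ⊎ B → Fin k
  from (inj₁ x) = ⊥-elim (¬a x)
  from (inj₂ y) = fromB y
  to-from : ∀ y → inj₂ (toB (from y)) ≡ y
  to-from (inj₁ x) = ⊥-elim (¬a x)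
  to-from (inj₂ y) = cong inj₂ (strictlyInverseˡ y)

filter-enum : ∀ m (q : Fin m → Bool) b → Enumeration (Σ (Fin m) λ v → q v ≡ b)
filter-enum zero q b = 0 , mk↔ₛ′ (λ ()) (λ { (() , _) }) (λ { (() , _) }) (λ ())
filter-enum (suc m) q b with filter-enum m (q ∘ fsuc) b | q fzero ≟ᵇ b
... | k , e | yes p = suc k , ↔-trans (enum-point p bool-uip e) Σ-Fin-suc
... | k , e | no ¬p = k , ↔-trans (enum-skip ¬p e) Σ-Fin-suc

record Str (n : ℕ) : Set₁ where
  field
    V        : Set
    E        : V → V → Bool
    E-sym    : ∀ x y → E x y ≡ E y x
    E-irrefl : ∀ x → E x x ≡ false
    cls      : V → Fin n
open Str

record _≃_ {n : ℕ} (S T : Str n) : Set where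
  field
    to       : V S → V T
    from     : V T → V S
    to-from  : ∀ y → to (from y) ≡ y
    from-to  : ∀ x → from (to x) ≡ x
    E-pres   : ∀ x y → E T (to x) (to y) ≡ E S x y
    cls-pres : ∀ x → cls T (to x) ≡ cls S x
open _≃_
infix 4 _≃_

module _ {n : ℕ} where

  ≃-refl : {S : Str n} → S ≃ S
  ≃-refl = record { to = λ x → x ; from = λ x → x ; to-from = λ _ → refl
                  ; from-to = λ _ → refl ; E-pres = λ _ _ → refl ; cls-pres = λ _ → refl }

  ≃-sym : {S T : Str n} → S ≃ T → T ≃ S
  ≃-sym {S} {T} φ = record
    { to = from φ ; from = to φ ; to-from = from-to φ ; from-to = to-from φ
    ; E-pres = λ x y → trans (≡-sym (E-pres φ (from φ x) (from φ y)))
                             (cong₂ (E T) (to-from φ x) (to-from φ y))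
    ; cls-pres = λ x → trans (≡-sym (cls-pres φ (from φ x))) (cong (cls T) (to-from φ x)) }

  ≃-trans : {S T U : Str n} → S ≃ T → T ≃ U → S ≃ U
  ≃-trans φ ψ = record
    { to = to ψ ∘ to φ ; from = from φ ∘ from ψ
    ; to-from = λ y → trans (cong (to ψ) (to-from φ (from ψ y))) (to-from ψ y)
    ; from-to = λ x → trans (cong (from φ) (from-to ψ (to φ x))) (from-to φ x)
    ; E-pres = λ x y → trans (E-pres ψ (to φ x) (to φ y)) (E-pres φ x y)
    ; cls-pres = λ x → trans (cls-pres ψ (to φ x)) (cls-pres φ x) }

  ≃-setoid : Setoid (Level.suc Level.zero) Level.zero
  ≃-setoid = record { Carrier = Str n ; _≈_ = _≃_
                    ; isEquivalence = record { refl = ≃-refl ; sym = ≃-sym ; trans = ≃-trans } }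

  module ≃-Reasoning = SetoidReasoning ≃-setoid

  Sub : (S : Str n) → (V S → Bool) → Bool → Str n
  Sub S q b = record { V = Σ (V S) λ v → q v ≡ b
                     ; E = λ u w → E S (proj₁ u) (proj₁ w)
                     ; E-sym = λ u w → E-sym S (proj₁ u) (proj₁ w)
                     ; E-irrefl = λ u → E-irrefl S (proj₁ u)
                     ; cls = λ u → cls S (proj₁ u) }

  Sub-transport : {S T : Str n} (φ : S ≃ T) (q : V T → Bool) (b : Bool) →
                  Sub S (q ∘ to φ) b ≃ Sub T q b
  Sub-transport φ q b = record
    { to = λ u → to φ (proj₁ u) , proj₂ u
    ; from = λ w → from φ (proj₁ w) , subst (λ z → q z ≡ b) (≡-sym (to-from φ (proj₁ w))) (proj₂ w)
    ; to-from = λ w → subset-≡ (to-from φ (proj₁ w))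
    ; from-to = λ u → subset-≡ (from-to φ (proj₁ u))
    ; E-pres = λ u w → E-pres φ (proj₁ u) (proj₁ w)
    ; cls-pres = λ u → cls-pres φ (proj₁ u) }

  ⌊_⌋ : PGraph n → Str n
  ⌊ G ⌋ = record { V = Fin (size G) ; E = adj G ; E-sym = sym G
                 ; E-irrefl = irrefl G ; cls = part G }

  ≅⇒≃ : {G F : PGraph n} → G ≅ F → ⌊ G ⌋ ≃ ⌊ F ⌋
  ≅⇒≃ i = record { to = Inverse.to bij ; from = Inverse.from bij
                 ; to-from = Inverse.strictlyInverseˡ bij ; from-to = Inverse.strictlyInverseʳ bij
                 ; E-pres = adj-pres ; cls-pres = part-pres }
    where open _≅_ i

  ≃⇒≅ : {G F : PGraph n} → ⌊ G ⌋ ≃ ⌊ F ⌋ → G ≅ F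
  ≃⇒≅ φ = record { bij = mk↔ₛ′ (to φ) (from φ) (to-from φ) (from-to φ)
                 ; adj-pres = E-pres φ ; part-pres = cls-pres φ }

  fromEnum : (S : Str n) → Enumeration (V S) → PGraph n
  fromEnum S (k , e) = record
    { size = k ; adj = λ i j → E S (Inverse.to e i) (Inverse.to e j)
    ; sym = λ i j → E-sym S (Inverse.to e i) (Inverse.to e j)
    ; irrefl = λ i → E-irrefl S (Inverse.to e i) ; part = λ i → cls S (Inverse.to e i) }

  fromEnum≃ : (S : Str n) (en : Enumeration (V S)) → ⌊ fromEnum S en ⌋ ≃ S
  fromEnum≃ S (k , e) = record
    { to = Inverse.to e ; from = Inverse.from e
    ; to-from = Inverse.strictlyInverseˡ e ; from-to = Inverse.strictlyInverseʳ e
    ; E-pres = λ _ _ → refl ; cls-pres = λ _ → refl }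

  restrict : (G : PGraph n) → (Fin (size G) → Bool) → Bool → PGraph n
  restrict G q b = fromEnum (Sub ⌊ G ⌋ q b) (filter-enum (size G) q b)

  restrict≃ : (G : PGraph n) (q : Fin (size G) → Bool) (b : Bool) →
              ⌊ restrict G q b ⌋ ≃ Sub ⌊ G ⌋ q b
  restrict≃ G q b = fromEnum≃ (Sub ⌊ G ⌋ q b) (filter-enum (size G) q b)

  ∅ : PGraph n
  ∅ = record { size = 0 ; adj = λ () ; sym = λ () ; irrefl = λ () ; part = λ () }

  empty-or-nonempty : (G : PGraph n) → ¬ Fin (size G) ⊎ Nonempty G
  empty-or-nonempty G with size G
  ... | zero  = inj₁ λ ()
  ... | suc _ = inj₂ (s≤s z≤n)

isLeft : {A B : Set} → A ⊎ B → Bool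
isLeft (inj₁ _) = true
isLeft (inj₂ _) = false

module _ {n : ℕ} (H : Digraph n) where

  module Product (S T : Str n) where
    E⊗ : V S ⊎ V T → V S ⊎ V T → Bool
    E⊗ (inj₁ x) (inj₁ y) = E S x y
    E⊗ (inj₂ x) (inj₂ y) = E T x y
    E⊗ (inj₁ x) (inj₂ y) = H (cls S x) (cls T y)
    E⊗ (inj₂ y) (inj₁ x) = H (cls S x) (cls T y)

    E⊗-sym : ∀ u w → E⊗ u w ≡ E⊗ w u
    E⊗-sym (inj₁ x) (inj₁ y) = E-sym S x y
    E⊗-sym (inj₂ x) (inj₂ y) = E-sym T x y
    E⊗-sym (inj₁ x) (inj₂ y) = refl
    E⊗-sym (inj₂ y) (inj₁ x) = refl

    E⊗-irrefl : ∀ u → E⊗ u u ≡ false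
    E⊗-irrefl (inj₁ x) = E-irrefl S x
    E⊗-irrefl (inj₂ x) = E-irrefl T x

    cls⊗ : V S ⊎ V T → Fin n
    cls⊗ (inj₁ x) = cls S x
    cls⊗ (inj₂ x) = cls T x

  _⊗_ : Str n → Str n → Str n
  S ⊗ T = record { V = V S ⊎ V T ; E = E⊗ ; E-sym = E⊗-sym ; E-irrefl = E⊗-irrefl ; cls = cls⊗ }
    where open Product S T
  infixr 6 _⊗_

  ⊗-cong : {S S' T T' : Str n} → S ≃ S' → T ≃ T' → S ⊗ T ≃ S' ⊗ T'
  ⊗-cong {S} {S'} {T} {T'} φ ψ = record
    { to = to⊎ ; from = from⊎ ; to-from = to-from⊎ ; from-to = from-to⊎
    ; E-pres = E-pres⊎ ; cls-pres = cls-pres⊎ }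
    where
    to⊎ : V S ⊎ V T → V S' ⊎ V T'
    to⊎ (inj₁ x) = inj₁ (to φ x)
    to⊎ (inj₂ x) = inj₂ (to ψ x)
    from⊎ : V S' ⊎ V T' → V S ⊎ V T
    from⊎ (inj₁ x) = inj₁ (from φ x)
    from⊎ (inj₂ x) = inj₂ (from ψ x)
    to-from⊎ : ∀ y → to⊎ (from⊎ y) ≡ y
    to-from⊎ (inj₁ x) = cong inj₁ (to-from φ x)
    to-from⊎ (inj₂ x) = cong inj₂ (to-from ψ x)
    from-to⊎ : ∀ y → from⊎ (to⊎ y) ≡ y
    from-to⊎ (inj₁ x) = cong inj₁ (from-to φ x)
    from-to⊎ (inj₂ x) = cong inj₂ (from-to ψ x)
    E-pres⊎ : ∀ x y → E (S' ⊗ T') (to⊎ x) (to⊎ y) ≡ E (S ⊗ T) x y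
    E-pres⊎ (inj₁ x) (inj₁ y) = E-pres φ x y
    E-pres⊎ (inj₂ x) (inj₂ y) = E-pres ψ x y
    E-pres⊎ (inj₁ x) (inj₂ y) = cong₂ H (cls-pres φ x) (cls-pres ψ y)
    E-pres⊎ (inj₂ y) (inj₁ x) = cong₂ H (cls-pres φ x) (cls-pres ψ y)
    cls-pres⊎ : ∀ x → cls (S' ⊗ T') (to⊎ x) ≡ cls (S ⊗ T) x
    cls-pres⊎ (inj₁ x) = cls-pres φ x
    cls-pres⊎ (inj₂ x) = cls-pres ψ x

  ⊗-unitʳ : {S Z : Str n} → ¬ V Z → S ⊗ Z ≃ S
  ⊗-unitʳ {S} {Z} empty = record
    { to = to₁ ; from = inj₁ ; to-from = λ _ → refl ; from-to = from-to₁
    ; E-pres = E-pres₁ ; cls-pres = cls-pres₁ }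
    where
    to₁ : V S ⊎ V Z → V S
    to₁ (inj₁ x) = x
    to₁ (inj₂ z) = ⊥-elim (empty z)
    from-to₁ : ∀ x → inj₁ (to₁ x) ≡ x
    from-to₁ (inj₁ x) = refl
    from-to₁ (inj₂ z) = ⊥-elim (empty z)
    E-pres₁ : ∀ x y → E S (to₁ x) (to₁ y) ≡ E (S ⊗ Z) x y
    E-pres₁ (inj₁ x) (inj₁ y) = refl
    E-pres₁ (inj₂ z) _        = ⊥-elim (empty z)
    E-pres₁ (inj₁ x) (inj₂ z) = ⊥-elim (empty z)
    cls-pres₁ : ∀ x → cls S (to₁ x) ≡ cls (S ⊗ Z) x
    cls-pres₁ (inj₁ x) = refl
    cls-pres₁ (inj₂ z) = ⊥-elim (empty z)

  ⊗-unitˡ : {S Z : Str n} → ¬ V Z → Z ⊗ S ≃ S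
  ⊗-unitˡ {S} {Z} empty = record
    { to = to₂ ; from = inj₂ ; to-from = λ _ → refl ; from-to = from-to₂
    ; E-pres = E-pres₂ ; cls-pres = cls-pres₂ }
    where
    to₂ : V Z ⊎ V S → V S
    to₂ (inj₂ x) = x
    to₂ (inj₁ z) = ⊥-elim (empty z)
    from-to₂ : ∀ x → inj₂ (to₂ x) ≡ x
    from-to₂ (inj₂ x) = refl
    from-to₂ (inj₁ z) = ⊥-elim (empty z)
    E-pres₂ : ∀ x y → E S (to₂ x) (to₂ y) ≡ E (Z ⊗ S) x y
    E-pres₂ (inj₂ x) (inj₂ y) = refl
    E-pres₂ (inj₁ z) _        = ⊥-elim (empty z)
    E-pres₂ (inj₂ x) (inj₁ z) = ⊥-elim (empty z)
    cls-pres₂ : ∀ x → cls S (to₂ x) ≡ cls (Z ⊗ S) x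
    cls-pres₂ (inj₂ x) = refl
    cls-pres₂ (inj₁ z) = ⊥-elim (empty z)

  ⊗-swap : {S T : Str n} → (∀ x y → H (cls S x) (cls T y) ≡ H (cls T y) (cls S x)) →
           S ⊗ T ≃ T ⊗ S
  ⊗-swap {S} {T} H-sym = record
    { to = swap₁ ; from = swap₂ ; to-from = swap₁₂ ; from-to = swap₂₁
    ; E-pres = E-pres-swap ; cls-pres = cls-pres-swap }
    where
    swap₁ : V S ⊎ V T → V T ⊎ V S
    swap₁ (inj₁ x) = inj₂ x
    swap₁ (inj₂ y) = inj₁ y
    swap₂ : V T ⊎ V S → V S ⊎ V T
    swap₂ (inj₁ y) = inj₂ y
    swap₂ (inj₂ x) = inj₁ x
    swap₁₂ : ∀ u → swap₁ (swap₂ u) ≡ u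
    swap₁₂ (inj₁ y) = refl
    swap₁₂ (inj₂ x) = refl
    swap₂₁ : ∀ u → swap₂ (swap₁ u) ≡ u
    swap₂₁ (inj₁ x) = refl
    swap₂₁ (inj₂ y) = refl
    E-pres-swap : ∀ u w → E (T ⊗ S) (swap₁ u) (swap₁ w) ≡ E (S ⊗ T) u w
    E-pres-swap (inj₁ x) (inj₁ x') = refl
    E-pres-swap (inj₂ y) (inj₂ y') = refl
    E-pres-swap (inj₁ x) (inj₂ y)  = ≡-sym (H-sym x y)
    E-pres-swap (inj₂ y) (inj₁ x)  = ≡-sym (H-sym x y)
    cls-pres-swap : ∀ u → cls (T ⊗ S) (swap₁ u) ≡ cls (S ⊗ T) u
    cls-pres-swap (inj₁ x) = refl
    cls-pres-swap (inj₂ y) = refl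

  IsCut : (S : Str n) → (V S → Bool) → Set
  IsCut S q = ∀ x y → q x ≡ true → q y ≡ false → E S x y ≡ H (cls S x) (cls S y)

  isLeft-cut : (X Y : Str n) → IsCut (X ⊗ Y) isLeft
  isLeft-cut X Y (inj₁ x) (inj₂ y) _ _ = refl
  isLeft-cut X Y (inj₂ x) _        () _
  isLeft-cut X Y (inj₁ x) (inj₁ y) _ ()

  cut-transport : {S T : Str n} (φ : S ≃ T) {q : V T → Bool} → IsCut T q → IsCut S (q ∘ to φ)
  cut-transport {S} {T} φ cut x y qx qy = begin
    E S x y                                ≡⟨ E-pres φ x y ⟨
    E T (to φ x) (to φ y)                  ≡⟨ cut (to φ x) (to φ y) qx qy ⟩
    H (cls T (to φ x)) (cls T (to φ y))    ≡⟨ cong₂ H (cls-pres φ x) (cls-pres φ y) ⟩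
    H (cls S x) (cls S y)                  ∎
    where open ≡-Reasoning

  split : (S : Str n) (q : V S → Bool) → IsCut S q → S ≃ Sub S q true ⊗ Sub S q false
  split S q cut = record
    { to = λ v → side v (q v) refl ; from = vertex
    ; to-from = λ { (inj₁ (v , e)) → side-true v (q v) refl e
                  ; (inj₂ (v , e)) → side-false v (q v) refl e }
    ; from-to = λ v → vertex-side v (q v) refl
    ; E-pres = λ x y → side-E x (q x) refl y (q y) refl
    ; cls-pres = λ v → side-cls v (q v) refl }
    where
    S₂ : Str n
    S₂ = Sub S q true ⊗ Sub S q false
    side : (v : V S) (b : Bool) → q v ≡ b → V S₂
    side v true  e = inj₁ (v , e)
    side v false e = inj₂ (v , e)
    vertex : V S₂ → V S
    vertex (inj₁ u) = proj₁ u
    vertex (inj₂ u) = proj₁ u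
    side-true : ∀ v b (e₀ : q v ≡ b) (e : q v ≡ true) → side v b e₀ ≡ inj₁ (v , e)
    side-true v true  e₀ e = cong (λ p → inj₁ (v , p)) (bool-uip e₀ e)
    side-true v false e₀ e with () ← trans (≡-sym e₀) e
    side-false : ∀ v b (e₀ : q v ≡ b) (e : q v ≡ false) → side v b e₀ ≡ inj₂ (v , e)
    side-false v false e₀ e = cong (λ p → inj₂ (v , p)) (bool-uip e₀ e)
    side-false v true  e₀ e with () ← trans (≡-sym e) e₀
    vertex-side : ∀ v b (e : q v ≡ b) → vertex (side v b e) ≡ v
    vertex-side v true  e = refl
    vertex-side v false e = refl
    side-E : ∀ x bx (ex : q x ≡ bx) y by (ey : q y ≡ by) →
             E S₂ (side x bx ex) (side y by ey) ≡ E S x y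
    side-E x true  ex y true  ey = refl
    side-E x false ex y false ey = refl
    side-E x true  ex y false ey = ≡-sym (cut x y ex ey)
    side-E x false ex y true  ey = ≡-sym (trans (E-sym S x y) (cut y x ey ex))
    side-cls : ∀ v b (e : q v ≡ b) → cls S₂ (side v b e) ≡ cls S v
    side-cls v true  e = refl
    side-cls v false e = refl

  Sub-⊗ : (S T : Str n) (q : V (S ⊗ T) → Bool) (b : Bool) →
          Sub (S ⊗ T) q b ≃ Sub S (q ∘ inj₁) b ⊗ Sub T (q ∘ inj₂) b
  Sub-⊗ S T q b = record
    { to = to⊎ ; from = from⊎ ; to-from = to-from⊎ ; from-to = from-to⊎
    ; E-pres = E-pres⊎ ; cls-pres = cls-pres⊎ }
    where
    to⊎ : V (Sub (S ⊗ T) q b) → V (Sub S (q ∘ inj₁) b ⊗ Sub T (q ∘ inj₂) b)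
    to⊎ (inj₁ v , e) = inj₁ (v , e)
    to⊎ (inj₂ v , e) = inj₂ (v , e)
    from⊎ : V (Sub S (q ∘ inj₁) b ⊗ Sub T (q ∘ inj₂) b) → V (Sub (S ⊗ T) q b)
    from⊎ (inj₁ (v , e)) = inj₁ v , e
    from⊎ (inj₂ (v , e)) = inj₂ v , e
    to-from⊎ : ∀ y → to⊎ (from⊎ y) ≡ y
    to-from⊎ (inj₁ _) = refl
    to-from⊎ (inj₂ _) = refl
    from-to⊎ : ∀ x → from⊎ (to⊎ x) ≡ x
    from-to⊎ (inj₁ _ , _) = refl
    from-to⊎ (inj₂ _ , _) = refl
    E-pres⊎ : ∀ x y → E (Sub S (q ∘ inj₁) b ⊗ Sub T (q ∘ inj₂) b) (to⊎ x) (to⊎ y)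
                      ≡ E (Sub (S ⊗ T) q b) x y
    E-pres⊎ (inj₁ _ , _) (inj₁ _ , _) = refl
    E-pres⊎ (inj₁ _ , _) (inj₂ _ , _) = refl
    E-pres⊎ (inj₂ _ , _) (inj₁ _ , _) = refl
    E-pres⊎ (inj₂ _ , _) (inj₂ _ , _) = refl
    cls-pres⊎ : ∀ x → cls (Sub S (q ∘ inj₁) b ⊗ Sub T (q ∘ inj₂) b) (to⊎ x)
                      ≡ cls (Sub (S ⊗ T) q b) x
    cls-pres⊎ (inj₁ _ , _) = refl
    cls-pres⊎ (inj₂ _ , _) = refl

  left-side : (X Y : Str n) → Sub (X ⊗ Y) isLeft true ≃ X
  left-side X Y = record
    { to = to₁ ; from = λ x → inj₁ x , refl ; to-from = λ _ → refl ; from-to = from-to₁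
    ; E-pres = E-pres₁ ; cls-pres = cls-pres₁ }
    where
    to₁ : V (Sub (X ⊗ Y) isLeft true) → V X
    to₁ (inj₁ x , _) = x
    from-to₁ : ∀ u → (inj₁ (to₁ u) , refl) ≡ u
    from-to₁ (inj₁ x , refl) = refl
    E-pres₁ : ∀ u w → E X (to₁ u) (to₁ w) ≡ E (Sub (X ⊗ Y) isLeft true) u w
    E-pres₁ (inj₁ _ , _) (inj₁ _ , _) = refl
    cls-pres₁ : ∀ u → cls X (to₁ u) ≡ cls (Sub (X ⊗ Y) isLeft true) u
    cls-pres₁ (inj₁ _ , _) = refl

  right-side : (X Y : Str n) → Sub (X ⊗ Y) isLeft false ≃ Y
  right-side X Y = record
    { to = to₂ ; from = λ y → inj₂ y , refl ; to-from = λ _ → refl ; from-to = from-to₂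
    ; E-pres = E-pres₂ ; cls-pres = cls-pres₂ }
    where
    to₂ : V (Sub (X ⊗ Y) isLeft false) → V Y
    to₂ (inj₂ y , _) = y
    from-to₂ : ∀ u → (inj₂ (to₂ u) , refl) ≡ u
    from-to₂ (inj₂ y , refl) = refl
    E-pres₂ : ∀ u w → E Y (to₂ u) (to₂ w) ≡ E (Sub (X ⊗ Y) isLeft false) u w
    E-pres₂ (inj₂ _ , _) (inj₂ _ , _) = refl
    cls-pres₂ : ∀ u → cls Y (to₂ u) ≡ cls (Sub (X ⊗ Y) isLeft false) u
    cls-pres₂ (inj₂ _ , _) = refl

  -- Given φ : P ⊗ A ≃ X ⊗ Y, colour each vertex of P ⊗ A by
  -- the side of X ⊗ Y it is sent to.  The colouring is a cut, and the four
  -- coloured pieces P₁, P₂ of P and A₁, A₂ of A refine both factorisations.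
  module Refinement {P A X Y : Str n} (φ : P ⊗ A ≃ X ⊗ Y) where
    colour : V (P ⊗ A) → Bool
    colour = isLeft ∘ to φ

    colour-cut : IsCut (P ⊗ A) colour
    colour-cut = cut-transport φ (isLeft-cut X Y)

    P-split : P ≃ Sub P (colour ∘ inj₁) true ⊗ Sub P (colour ∘ inj₁) false
    P-split = split P (colour ∘ inj₁) (λ x y → colour-cut (inj₁ x) (inj₁ y))

    A-split : A ≃ Sub A (colour ∘ inj₂) true ⊗ Sub A (colour ∘ inj₂) false
    A-split = split A (colour ∘ inj₂) (λ x y → colour-cut (inj₂ x) (inj₂ y))

    side-split : (b : Bool) → Sub (X ⊗ Y) isLeft b ≃
                 Sub P (colour ∘ inj₁) b ⊗ Sub A (colour ∘ inj₂) b
    side-split b = ≃-trans (≃-sym (Sub-transport φ isLeft b)) (Sub-⊗ P A colour b)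

    X-split : X ≃ Sub P (colour ∘ inj₁) true ⊗ Sub A (colour ∘ inj₂) true
    X-split = ≃-trans (≃-sym (left-side X Y)) (side-split true)

    Y-split : Y ≃ Sub P (colour ∘ inj₁) false ⊗ Sub A (colour ∘ inj₂) false
    Y-split = ≃-trans (≃-sym (right-side X Y)) (side-split false)

    -- The cut condition between A₁ and P₂ says that H is symmetric between them.
    middle-commute : Sub A (colour ∘ inj₂) true ⊗ Sub P (colour ∘ inj₁) false ≃
                     Sub P (colour ∘ inj₁) false ⊗ Sub A (colour ∘ inj₂) true
    middle-commute = ⊗-swap λ a p →
      ≡-sym (colour-cut (inj₂ (proj₁ a)) (inj₁ (proj₁ p)) (proj₂ a) (proj₂ p))

  ∘≃⊗ : {G F : PGraph n} → ⌊ G ∘[ H ] F ⌋ ≃ ⌊ G ⌋ ⊗ ⌊ F ⌋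
  ∘≃⊗ {G} {F} = record
    { to = splitAt (size G) ; from = join (size G) (size F)
    ; to-from = splitAt-join (size G) (size F) ; from-to = join-splitAt (size G) (size F)
    ; E-pres = λ x y → E-agrees (splitAt (size G) x) (splitAt (size G) y)
    ; cls-pres = λ x → cls-agrees (splitAt (size G) x) }
    where
    E-agrees : ∀ u w → E (⌊ G ⌋ ⊗ ⌊ F ⌋) u w ≡ ProdDef.adj⊎ H G F u w
    E-agrees (inj₁ x) (inj₁ y) = refl
    E-agrees (inj₁ x) (inj₂ y) = refl
    E-agrees (inj₂ x) (inj₁ y) = refl
    E-agrees (inj₂ x) (inj₂ y) = refl
    cls-agrees : ∀ u → cls (⌊ G ⌋ ⊗ ⌊ F ⌋) u ≡ ProdDef.part⊎ H G F u
    cls-agrees (inj₁ x) = refl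
    cls-agrees (inj₂ x) = refl

  ∘-commute : {G F : PGraph n} {X Y : Str n} → ⌊ G ⌋ ≃ X → ⌊ F ⌋ ≃ Y →
              X ⊗ Y ≃ Y ⊗ X → G ∘[ H ] F ≅ F ∘[ H ] G
  ∘-commute {G} {F} {X} {Y} G≃X F≃Y X⊗Y≃Y⊗X = ≃⇒≅ (begin
    ⌊ G ∘[ H ] F ⌋   ≈⟨ ∘≃⊗ ⟩
    ⌊ G ⌋ ⊗ ⌊ F ⌋    ≈⟨ ⊗-cong G≃X F≃Y ⟩
    X ⊗ Y            ≈⟨ X⊗Y≃Y⊗X ⟩
    Y ⊗ X            ≈⟨ ⊗-cong F≃Y G≃X ⟨
    ⌊ F ⌋ ⊗ ⌊ G ⌋    ≈⟨ ∘≃⊗ ⟨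
    ⌊ F ∘[ H ] G ⌋   ∎)
    where open ≃-Reasoning

  record CommonRefinement (P A : PGraph n) (X Y : Str n) : Set where
    field
      P₁ P₂ A₁ A₂ : PGraph n
      P≃      : ⌊ P ⌋ ≃ ⌊ P₁ ⌋ ⊗ ⌊ P₂ ⌋
      A≃      : ⌊ A ⌋ ≃ ⌊ A₁ ⌋ ⊗ ⌊ A₂ ⌋
      X≃      : X ≃ ⌊ P₁ ⌋ ⊗ ⌊ A₁ ⌋
      Y≃      : Y ≃ ⌊ P₂ ⌋ ⊗ ⌊ A₂ ⌋
      commute : ⌊ A₁ ⌋ ⊗ ⌊ P₂ ⌋ ≃ ⌊ P₂ ⌋ ⊗ ⌊ A₁ ⌋

  refine : (P A : PGraph n) {X Y : Str n} → ⌊ P ⌋ ⊗ ⌊ A ⌋ ≃ X ⊗ Y → CommonRefinement P A X Y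
  refine P A φ = record
    { P₁ = restrict P qP true ; P₂ = restrict P qP false
    ; A₁ = restrict A qA true ; A₂ = restrict A qA false
    ; P≃ = ≃-trans P-split (⊗-cong (≃-sym (P↾ true)) (≃-sym (P↾ false)))
    ; A≃ = ≃-trans A-split (⊗-cong (≃-sym (A↾ true)) (≃-sym (A↾ false)))
    ; X≃ = ≃-trans X-split (⊗-cong (≃-sym (P↾ true)) (≃-sym (A↾ true)))
    ; Y≃ = ≃-trans Y-split (⊗-cong (≃-sym (P↾ false)) (≃-sym (A↾ false)))
    ; commute = ≃-trans (⊗-cong (A↾ true) (P↾ false))
                  (≃-trans middle-commute (⊗-cong (≃-sym (P↾ false)) (≃-sym (A↾ true)))) }
    where
    open Refinement φ
    qP : Fin (size P) → Bool
    qP = colour ∘ inj₁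
    qA : Fin (size A) → Bool
    qA = colour ∘ inj₂
    P↾ : (b : Bool) → ⌊ restrict P qP b ⌋ ≃ Sub ⌊ P ⌋ qP b
    P↾ = restrict≃ P qP
    A↾ : (b : Bool) → ⌊ restrict A qA b ⌋ ≃ Sub ⌊ A ⌋ qA b
    A↾ = restrict≃ A qA

  prodList : List (PGraph n) → PGraph n
  prodList []       = ∅
  prodList (S ∷ Ss) = S ∘[ H ] prodList Ss

  prodSeq≃prodList : (T : PGraph n) (Ts : List (PGraph n)) →
                     ⌊ prodSeq H T Ts ⌋ ≃ ⌊ prodList (T ∷ Ts) ⌋
  prodSeq≃prodList T []       = ≃-sym (≃-trans ∘≃⊗ (⊗-unitʳ (λ ())))
  prodSeq≃prodList T (S ∷ Ss) =
    ≃-trans ∘≃⊗ (≃-trans (⊗-cong ≃-refl (prodSeq≃prodList S Ss)) (≃-sym ∘≃⊗))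

  prodList-vertex : (T : PGraph n) (Ts : List (PGraph n)) →
                    Nonempty T → Fin (size (prodList (T ∷ Ts)))
  prodList-vertex T Ts (s≤s z≤n) = from (∘≃⊗ {T} {prodList Ts}) (inj₁ fzero)

  prime-split : {G B C : PGraph n} → HPrime H G → ⌊ G ⌋ ≃ ⌊ B ⌋ ⊗ ⌊ C ⌋ →
                Nonempty B → ¬ Fin (size C)
  prime-split {G} {B} {C} prime φ B-nonempty with empty-or-nonempty C
  ... | inj₁ C-empty    = C-empty
  ... | inj₂ C-nonempty =
    ⊥-elim (prime (B , C , B-nonempty , C-nonempty , ≃⇒≅ (≃-trans φ (≃-sym ∘≃⊗))))

  swap-length : {xs ys : List (PGraph n)} → SwapStep H xs ys → length xs ≡ length ys
  swap-length (swap xs _ _ _ _) = trans (length-++ xs) (≡-sym (length-++ xs))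

  swaps-length : {xs ys : List (PGraph n)} → Swaps H xs ys → length xs ≡ length ys
  swaps-length = fold (λ xs ys → length xs ≡ length ys) (trans ∘ swap-length) refl

  swap-All : {Q : PGraph n → Set} {xs ys : List (PGraph n)} →
             SwapStep H xs ys → All Q xs → All Q ys
  swap-All (swap xs _ _ _ _) all with ++⁻ xs all
  ... | all-xs , (q-P ∷ q-R ∷ all-ys) = ++⁺ all-xs (q-R ∷ q-P ∷ all-ys)

  swaps-All : {Q : PGraph n → Set} {xs ys : List (PGraph n)} →
              Swaps H xs ys → All Q xs → All Q ys
  swaps-All = fold (λ xs ys → All _ xs → All _ ys) (λ s k → k ∘ swap-All s) (λ a → a)

  swaps-cons : {x : PGraph n} {xs ys : List (PGraph n)} →
               Swaps H xs ys → Swaps H (x ∷ xs) (x ∷ ys)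
  swaps-cons {x} = gmap (x ∷_) λ { (swap xs P Q ys c) → swap (x ∷ xs) P Q ys c }

  record Extraction (P A : PGraph n) (Ts : List (PGraph n)) : Set where
    constructor extracted
    field
      front  : PGraph n
      rest   : List (PGraph n)
      swaps  : Swaps H Ts (front ∷ rest)
      front≃ : ⌊ front ⌋ ≃ ⌊ P ⌋
      rest≃  : ⌊ A ⌋ ≃ ⌊ prodList rest ⌋

  module _ {P A : PGraph n} (T : PGraph n) (Ts : List (PGraph n))
           (R : CommonRefinement P A ⌊ T ⌋ ⌊ prodList Ts ⌋) where
    open CommonRefinement R
    open ≃-Reasoning

    -- If P₁ is nonempty, primality empties A₁ and P₂: the first factor T is P.
    extract-here : HPrime H P → HPrime H T → Nonempty P₁ → Extraction P A (T ∷ Ts)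
    extract-here P-prime T-prime P₁-nonempty = extracted T Ts ε T≃P A≃rest
      where
      A₁-empty : ¬ Fin (size A₁)
      A₁-empty = prime-split T-prime X≃ P₁-nonempty
      P₂-empty : ¬ Fin (size P₂)
      P₂-empty = prime-split P-prime P≃ P₁-nonempty
      T≃P : ⌊ T ⌋ ≃ ⌊ P ⌋
      T≃P = begin
        ⌊ T ⌋             ≈⟨ X≃ ⟩
        ⌊ P₁ ⌋ ⊗ ⌊ A₁ ⌋   ≈⟨ ⊗-unitʳ A₁-empty ⟩
        ⌊ P₁ ⌋            ≈⟨ ⊗-unitʳ P₂-empty ⟨
        ⌊ P₁ ⌋ ⊗ ⌊ P₂ ⌋   ≈⟨ P≃ ⟨
        ⌊ P ⌋             ∎
      A≃rest : ⌊ A ⌋ ≃ ⌊ prodList Ts ⌋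
      A≃rest = begin
        ⌊ A ⌋             ≈⟨ A≃ ⟩
        ⌊ A₁ ⌋ ⊗ ⌊ A₂ ⌋   ≈⟨ ⊗-unitˡ A₁-empty ⟩
        ⌊ A₂ ⌋            ≈⟨ ⊗-unitˡ P₂-empty ⟨
        ⌊ P₂ ⌋ ⊗ ⌊ A₂ ⌋   ≈⟨ Y≃ ⟨
        ⌊ prodList Ts ⌋   ∎

    -- If P₁ is empty, then P ≃ P₂ and T ≃ A₁ commute, and P is a factor of the
    -- remaining product; an extraction from Ts is moved past T.
    P≃P₂ : ¬ Fin (size P₁) → ⌊ P ⌋ ≃ ⌊ P₂ ⌋
    P≃P₂ P₁-empty = ≃-trans P≃ (⊗-unitˡ P₁-empty)

    behind : ¬ Fin (size P₁) → ⌊ P ⌋ ⊗ ⌊ A₂ ⌋ ≃ ⌊ prodList Ts ⌋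
    behind P₁-empty = ≃-trans (⊗-cong (P≃P₂ P₁-empty) ≃-refl) (≃-sym Y≃)

    extract-later : (P₁-empty : ¬ Fin (size P₁)) → Extraction P A₂ Ts → Extraction P A (T ∷ Ts)
    extract-later P₁-empty (extracted T' rest sw T'≃P A₂≃rest) =
      extracted T' (T ∷ rest) (swaps-cons sw ◅◅ (swap [] T T' rest T∘T'≅T'∘T ◅ ε)) T'≃P A≃rest
      where
      T≃A₁ : ⌊ T ⌋ ≃ ⌊ A₁ ⌋
      T≃A₁ = ≃-trans X≃ (⊗-unitˡ P₁-empty)
      T∘T'≅T'∘T : T ∘[ H ] T' ≅ T' ∘[ H ] T
      T∘T'≅T'∘T = ∘-commute T≃A₁ (≃-trans T'≃P (P≃P₂ P₁-empty)) commute
      A≃rest : ⌊ A ⌋ ≃ ⌊ prodList (T ∷ rest) ⌋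
      A≃rest = begin
        ⌊ A ⌋                     ≈⟨ A≃ ⟩
        ⌊ A₁ ⌋ ⊗ ⌊ A₂ ⌋           ≈⟨ ⊗-cong (≃-sym T≃A₁) A₂≃rest ⟩
        ⌊ T ⌋ ⊗ ⌊ prodList rest ⌋ ≈⟨ ∘≃⊗ ⟨
        ⌊ prodList (T ∷ rest) ⌋   ∎

  extract : (P A : PGraph n) (Ts : List (PGraph n)) → Nonempty P → HPrime H P →
            All (HPrime H) Ts → ⌊ P ⌋ ⊗ ⌊ A ⌋ ≃ ⌊ prodList Ts ⌋ → Extraction P A Ts
  extract P A [] (s≤s z≤n) _ _ φ with () ← to φ (inj₁ fzero)
  extract P A (T ∷ Ts) P-nonempty P-prime (T-prime ∷ Ts-prime) φ
    with R ← refine P A (≃-trans φ ∘≃⊗)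
    with empty-or-nonempty (CommonRefinement.P₁ R)
  ... | inj₂ P₁-nonempty = extract-here T Ts R P-prime T-prime P₁-nonempty
  ... | inj₁ P₁-empty    = extract-later T Ts R P₁-empty
    (extract P (CommonRefinement.A₂ R) Ts P-nonempty P-prime Ts-prime (behind T Ts R P₁-empty))

  unique-factorisation : (Ts Rs : List (PGraph n)) → All Nonempty Ts → All Nonempty Rs →
    All (HPrime H) Ts → All (HPrime H) Rs → ⌊ prodList Ts ⌋ ≃ ⌊ prodList Rs ⌋ →
    length Ts ≡ length Rs × Σ (List (PGraph n)) (λ Ss → Swaps H Ts Ss × Pointwise _≅_ Ss Rs)
  unique-factorisation [] [] _ _ _ _ _ = refl , [] , ε , []
  unique-factorisation (T ∷ Ts) [] (T-nonempty ∷ _) _ _ _ φ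
    with () ← to φ (prodList-vertex T Ts T-nonempty)
  unique-factorisation Ts (R ∷ Rs) Ts-nonempty (R-nonempty ∷ Rs-nonempty)
                       Ts-prime (R-prime ∷ Rs-prime) φ
    with extracted T' rest sw T'≃R Rs≃rest ←
           extract R (prodList Rs) Ts R-nonempty R-prime Ts-prime (≃-trans (≃-sym ∘≃⊗) (≃-sym φ))
    with _ ∷ rest-nonempty ← swaps-All sw Ts-nonempty
    with _ ∷ rest-prime ← swaps-All sw Ts-prime
    with length≡ , Ss , sw' , Ss≅Rs ←
           unique-factorisation rest Rs rest-nonempty Rs-nonempty rest-prime Rs-prime (≃-sym Rs≃rest)
    = trans (swaps-length sw) (cong suc length≡) , T' ∷ Ss , sw ◅◅ swaps-cons sw' , ≃⇒≅ T'≃R ∷ Ss≅Rs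

theorem5 : (n : ℕ) (H : Digraph n) (T : PGraph n)
    (T₁ R₁ : PGraph n) (Ts Rs : List (PGraph n)) →
    All Nonempty (T₁ ∷ Ts) → All Nonempty (R₁ ∷ Rs) →
    All (HPrime H) (T₁ ∷ Ts) → All (HPrime H) (R₁ ∷ Rs) →
    T ≅ prodSeq H T₁ Ts → T ≅ prodSeq H R₁ Rs →
    length (T₁ ∷ Ts) ≡ length (R₁ ∷ Rs)
    × Σ (List (PGraph n))
    (λ Ss → Swaps H (T₁ ∷ Ts) Ss × Pointwise _≅_ Ss (R₁ ∷ Rs))
theorem5 n H T T₁ R₁ Ts Rs T-nonempty R-nonempty T-prime R-prime T≅Ts T≅Rs =
  unique-factorisation H (T₁ ∷ Ts) (R₁ ∷ Rs) T-nonempty R-nonempty T-prime R-prime (begin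
    ⌊ prodList H (T₁ ∷ Ts) ⌋ ≈⟨ prodSeq≃prodList H T₁ Ts ⟨
    ⌊ prodSeq H T₁ Ts ⌋      ≈⟨ ≅⇒≃ T≅Ts ⟨
    ⌊ T ⌋                    ≈⟨ ≅⇒≃ T≅Rs ⟩
    ⌊ prodSeq H R₁ Rs ⌋      ≈⟨ prodSeq≃prodList H R₁ Rs ⟩
    ⌊ prodList H (R₁ ∷ Rs) ⌋ ∎)
  where open ≃-Reasoning
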